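{- For any positive integers $n, i_1,\ldots,i_n$ we have $$\Omega(i_1,\ldots,i_n)=\sum_{k=1}^{n}\Omega(i_1,\ldots,i_{k-1},\,i_k-1,\,i_{k+1},\ldots,i_n),$$ i.e. $\Omega(i_1,\ldots,i_n)=\Omega(i_1-1,i_2,\ldots,i_n)+\Omega(i_1,i_2-1,i_3,\ldots,i_n)+\cdots+\Omega(i_1,\ldots,i_{n-1},i_n-1)$.
   Context: A permutation $\tau$ of $\{0,\ldots,N\}$ is said to increase (resp. decrease) on a set $\{p,\ldots,q\}\subseteq\{0,\ldots,N\}$ if $\tau(j)<\tau(j+1)$ (resp. $\tau(j)>\tau(j+1)$) for every $j=p,\ldots,q-1$ (vacuous when $p=q$). For a finite sequence $a_1,\ldots,a_m$ of nonnegative integers ($m\ge1$), put $N:=a_1+\cdots+a_m$, $t_0:=0$, $t_k:=a_1+\cdots+a_k$. Then $\Omega(a_1,\ldots,a_m)$ denotes the number of permutations of $\{0,\ldots,N\}$ which, for every $k=1,\ldots,m$, increase on $\{t_{k-1},\ldots,t_k\}$ if $k$ is odd and decrease on $\{t_{k-1},\ldots,t_k\}$ if $k$ is even. -}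

module Defs where

open import Data.Nat using (ℕ; zero; suc; _+_; _<ᵇ_; _≡ᵇ_)
open import Data.Bool using (Bool; true; false; _∧_; not; if_then_else_)
open import Data.List using (List; []; _∷_; _++_; length; replicate; filter; concatMap; upTo; map)
open import Data.Nat.ListAction using (sum)
open import Relation.Nullary.Decidable using (does)
open import Data.Bool.Properties using (T?)

-- A permutation τ of {0,…,N} is represented by its table of values
-- [τ(0), τ(1), …, τ(N)] : List ℕ.

tables : ℕ → ℕ → List (List ℕ)
tables zero    k = [] ∷ []
tables (suc m) k = concatMap (λ x → map (x ∷_) (tables m k)) (upTo k)

notIn : ℕ → List ℕ → Bool
notIn x []       = true
notIn x (y ∷ ys) = not (x ≡ᵇ y) ∧ notIn x ys

distinct : List ℕ → Bool
distinct []       = true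
distinct (x ∷ xs) = notIn x xs ∧ distinct xs

perms : ℕ → List (List ℕ)
perms N = filter (λ τ → T? (distinct τ)) (tables (suc N) (suc N))

-- Direction of each step j → j+1 (j = 0..N-1): true = must increase, false = must decrease.
-- Block k (1-based) of length a_k gets "increase" if k is odd, "decrease" if k is even.
dirsFrom : Bool → List ℕ → List Bool
dirsFrom b []       = []
dirsFrom b (a ∷ as) = replicate a b ++ dirsFrom (not b) as

dirs : List ℕ → List Bool
dirs as = dirsFrom true as

follows : List Bool → List ℕ → Bool
follows (d ∷ ds) (x ∷ y ∷ τ) =
  (if d then x <ᵇ y else y <ᵇ x) ∧ follows ds (y ∷ τ)
follows _ _ = true

-- Ω(a_1,…,a_m): number of permutations of {0,…,N}, N = a_1+⋯+a_m, increasing on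
-- {t_{k-1},…,t_k} for odd k and decreasing there for even k.
Ω : List ℕ → ℕ
Ω as = length (filter (λ τ → T? (follows (dirs as) τ)) (perms (sum as)))

-- Idea: in a permutation τ of {0,…,N} following the up/down pattern w = dirs L,
-- the maximal value N must sit at a peak of w.  Deleting it leaves a permutation σ
-- of {0,…,N-1}, and the two steps around the peak merge into a single step between
-- letters of σ that may go either way.  The peaks of a block pattern are the ends of
-- its ascending blocks, and merging the steps around a peak amounts to shortening
-- one of the two adjacent blocks; so the patterns obtained are exactly those of the
-- sequences with one entry lowered by one.
module Submission where

open import Defs
open import Algebra.Properties.CommutativeSemigroup using (interchange; x∙yz≈y∙xz)
open import Data.Bool using (Bool; true; false; _∧_; not; if_then_else_)
open import Data.Bool.Properties using (T?)
open import Data.Fin using (Fin)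
open import Data.List using (List; []; _∷_; _++_; map; allFin; length; replicate; filter; concatMap; applyUpTo; upTo; tabulate)
open import Data.List.Properties using (map-++; map-∘; map-id; map-cong; map-cong-local; map-tabulate; length-++; length-replicate)
import Data.List.Relation.Unary.All as List
open import Data.List.Relation.Unary.All.Properties using (map⁺)
open import Data.Nat using (ℕ; zero; suc; _≤_; pred; _+_; _*_; _<_; z≤n; s≤s; _<ᵇ_; _≡ᵇ_)
open import Data.Nat.ListAction using (sum)
open import Data.Nat.ListAction.Properties using (sum-++)
open import Data.Nat.Properties using (+-identityʳ; +-assoc; +-comm; +-suc; *-distribˡ-+; *-assoc; *-comm; *-zeroʳ; +-commutativeSemigroup; *-commutativeSemigroup; ≤-refl; m≤n⇒m≤1+n)
open import Data.Vec using (Vec; toList; _[_]%=_)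
import Data.Vec as Vec
open import Data.Vec.Relation.Unary.All using (All)
open import Data.Vec.Relation.Unary.All.Properties using (toList⁺)
open import Function using (_∘_)
open import Relation.Binary.PropositionalEquality using (_≡_; refl; sym; trans; cong; cong₂; module ≡-Reasoning)

open ≡-Reasoning

𝟙 : Bool → ℕ
𝟙 true  = 1
𝟙 false = 0

𝟙-∧ : ∀ a b → 𝟙 (a ∧ b) ≡ 𝟙 a * 𝟙 b
𝟙-∧ true  b = sym (+-identityʳ (𝟙 b))
𝟙-∧ false b = refl

sumBelow : ℕ → (ℕ → ℕ) → ℕ
sumBelow zero    f = 0
sumBelow (suc n) f = f 0 + sumBelow n (f ∘ suc)

syntax sumBelow n (λ x → e) = Σ[ x < n ] e

Σ-cong< : ∀ n {f g : ℕ → ℕ} → (∀ x → x < n → f x ≡ g x) → Σ[ x < n ] f x ≡ Σ[ x < n ] g x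
Σ-cong< zero    f≡g = refl
Σ-cong< (suc n) f≡g = cong₂ _+_ (f≡g 0 (s≤s z≤n)) (Σ-cong< n (λ x x<n → f≡g (suc x) (s≤s x<n)))

Σ-cong : ∀ n {f g : ℕ → ℕ} → (∀ x → f x ≡ g x) → Σ[ x < n ] f x ≡ Σ[ x < n ] g x
Σ-cong n f≡g = Σ-cong< n (λ x _ → f≡g x)

Σ-last : ∀ n (f : ℕ → ℕ) → Σ[ x < suc n ] f x ≡ (Σ[ x < n ] f x) + f n
Σ-last zero    f = +-comm (f 0) 0
Σ-last (suc n) f = trans (cong (f 0 +_) (Σ-last n (f ∘ suc))) (sym (+-assoc (f 0) _ _))

Σ-zero : ∀ n → Σ[ x < n ] 0 ≡ 0
Σ-zero zero    = refl
Σ-zero (suc n) = Σ-zero n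

Σ-+ : ∀ n (f g : ℕ → ℕ) → Σ[ x < n ] (f x + g x) ≡ (Σ[ x < n ] f x) + (Σ[ x < n ] g x)
Σ-+ zero    f g = refl
Σ-+ (suc n) f g = trans (cong (f 0 + g 0 +_) (Σ-+ n (f ∘ suc) (g ∘ suc)))
                        (interchange +-commutativeSemigroup (f 0) (g 0) _ _)

Σ-* : ∀ n c (f : ℕ → ℕ) → Σ[ x < n ] (c * f x) ≡ c * Σ[ x < n ] f x
Σ-* zero    c f = sym (*-zeroʳ c)
Σ-* (suc n) c f = trans (cong (c * f 0 +_) (Σ-* n c (f ∘ suc))) (sym (*-distribˡ-+ c (f 0) _))

Σ-comm : ∀ n m (h : ℕ → ℕ → ℕ) → Σ[ x < n ] Σ[ p < m ] h x p ≡ Σ[ p < m ] Σ[ x < n ] h x p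
Σ-comm zero    m h = sym (Σ-zero m)
Σ-comm (suc n) m h = trans (cong ((Σ[ p < m ] h 0 p) +_) (Σ-comm n m (h ∘ suc)))
                           (sym (Σ-+ m (h 0) (λ p → Σ[ x < n ] h (suc x) p)))

-- Sums over words: Σ[ σ ∈ k ^ m ] f σ adds f σ over all words σ of length m
-- with letters in {0,…,k-1}.  Ω is such a sum (lemma Ω-as-wordSum), and the
-- recursion on the first letter makes it amenable to induction.
wordSum : ℕ → ℕ → (List ℕ → ℕ) → ℕ
wordSum zero    k f = f []
wordSum (suc m) k f = Σ[ x < k ] wordSum m k (λ σ → f (x ∷ σ))

syntax wordSum m k (λ σ → e) = Σ[ σ ∈ k ^ m ] e

wordSum-cong : ∀ m k {f g : List ℕ → ℕ} →
  (∀ σ → length σ ≡ m → List.All (_< k) σ → f σ ≡ g σ) → wordSum m k f ≡ wordSum m k g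
wordSum-cong zero    k f≡g = f≡g [] refl List.[]
wordSum-cong (suc m) k f≡g = Σ-cong< k (λ x x<k → wordSum-cong m k
  (λ σ |σ|≡m σ<k → f≡g (x ∷ σ) (cong suc |σ|≡m) (x<k List.∷ σ<k)))

wordSum-ext : ∀ m k {f g : List ℕ → ℕ} → (∀ σ → f σ ≡ g σ) → wordSum m k f ≡ wordSum m k g
wordSum-ext m k f≡g = wordSum-cong m k (λ σ _ _ → f≡g σ)

wordSum-zero : ∀ m k → Σ[ σ ∈ k ^ m ] 0 ≡ 0
wordSum-zero zero    k = refl
wordSum-zero (suc m) k = trans (Σ-cong k (λ x → wordSum-zero m k)) (Σ-zero k)

wordSum-+ : ∀ m k (f g : List ℕ → ℕ) →
  Σ[ σ ∈ k ^ m ] (f σ + g σ) ≡ (Σ[ σ ∈ k ^ m ] f σ) + (Σ[ σ ∈ k ^ m ] g σ)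
wordSum-+ zero    k f g = refl
wordSum-+ (suc m) k f g =
  trans (Σ-cong k (λ x → wordSum-+ m k (f ∘ (x ∷_)) (g ∘ (x ∷_)))) (Σ-+ k _ _)

wordSum-Σ : ∀ m k n (f : ℕ → List ℕ → ℕ) →
  Σ[ σ ∈ k ^ m ] Σ[ p < n ] f p σ ≡ Σ[ p < n ] Σ[ σ ∈ k ^ m ] f p σ
wordSum-Σ m k zero    f = wordSum-zero m k
wordSum-Σ m k (suc n) f =
  trans (wordSum-+ m k (f 0) _) (cong (wordSum m k (f 0) +_) (wordSum-Σ m k n (f ∘ suc)))

wordSum-sum : ∀ {A : Set} m k (f : A → List ℕ → ℕ) vs →
  Σ[ σ ∈ k ^ m ] sum (map (λ v → f v σ) vs) ≡ sum (map (λ v → Σ[ σ ∈ k ^ m ] f v σ) vs)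
wordSum-sum m k f []       = wordSum-zero m k
wordSum-sum m k f (v ∷ vs) =
  trans (wordSum-+ m k (f v) _) (cong (wordSum m k (f v) +_) (wordSum-sum m k f vs))

sum-concatMap-cons : ∀ (h : List ℕ → ℕ) (T : List (List ℕ)) xs →
  sum (map h (concatMap (λ x → map (x ∷_) T) xs)) ≡ sum (map (λ x → sum (map (h ∘ (x ∷_)) T)) xs)
sum-concatMap-cons h T []       = refl
sum-concatMap-cons h T (x ∷ xs) = begin
  sum (map h (map (x ∷_) T ++ concatMap (λ x → map (x ∷_) T) xs))
    ≡⟨ cong sum (map-++ h (map (x ∷_) T) _) ⟩
  sum (map h (map (x ∷_) T) ++ map h (concatMap (λ x → map (x ∷_) T) xs))
    ≡⟨ sum-++ (map h (map (x ∷_) T)) _ ⟩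
  sum (map h (map (x ∷_) T)) + sum (map h (concatMap (λ x → map (x ∷_) T) xs))
    ≡⟨ cong₂ _+_ (cong sum (sym (map-∘ T))) (sum-concatMap-cons h T xs) ⟩
  sum (map (h ∘ (x ∷_)) T) + sum (map (λ x → sum (map (h ∘ (x ∷_)) T)) xs) ∎

sum-applyUpTo : ∀ k (f g : ℕ → ℕ) → sum (map g (applyUpTo f k)) ≡ Σ[ x < k ] g (f x)
sum-applyUpTo zero    f g = refl
sum-applyUpTo (suc k) f g = cong (g (f 0) +_) (sum-applyUpTo k (f ∘ suc) g)

sum-tables : ∀ m k (h : List ℕ → ℕ) → sum (map h (tables m k)) ≡ Σ[ σ ∈ k ^ m ] h σ
sum-tables zero    k h = +-identityʳ (h [])
sum-tables (suc m) k h = begin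
  sum (map h (concatMap (λ x → map (x ∷_) (tables m k)) (upTo k)))
    ≡⟨ sum-concatMap-cons h (tables m k) (upTo k) ⟩
  sum (map (λ x → sum (map (h ∘ (x ∷_)) (tables m k))) (upTo k))
    ≡⟨ sum-applyUpTo k (λ x → x) _ ⟩
  Σ[ x < k ] sum (map (h ∘ (x ∷_)) (tables m k))
    ≡⟨ Σ-cong k (λ x → sum-tables m k (h ∘ (x ∷_))) ⟩
  Σ[ x < k ] wordSum m k (h ∘ (x ∷_)) ∎

length-filter-filter : ∀ {A : Set} (f g : A → Bool) xs →
  length (filter (T? ∘ g) (filter (T? ∘ f) xs)) ≡ sum (map (λ τ → 𝟙 (f τ) * 𝟙 (g τ)) xs)
length-filter-filter f g [] = refl
length-filter-filter f g (x ∷ xs) with f x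
... | false = length-filter-filter f g xs
... | true with g x
...   | false = length-filter-filter f g xs
...   | true  = cong suc (length-filter-filter f g xs)

ifDistinct : (List ℕ → ℕ) → List ℕ → ℕ
ifDistinct P τ = 𝟙 (distinct τ) * P τ

Ω-as-wordSum : ∀ L → let N = sum L in
  Ω L ≡ Σ[ τ ∈ suc N ^ suc N ] ifDistinct (𝟙 ∘ follows (dirs L)) τ
Ω-as-wordSum L =
  trans (length-filter-filter distinct (follows (dirs L)) (tables (suc (sum L)) (suc (sum L))))
        (sum-tables (suc (sum L)) (suc (sum L)) _)

≡ᵇ-refl : ∀ n → (n ≡ᵇ n) ≡ true
≡ᵇ-refl zero    = refl
≡ᵇ-refl (suc n) = ≡ᵇ-refl n

<⇒≢ᵇ : ∀ {x k} → x < k → (x ≡ᵇ k) ≡ false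
<⇒≢ᵇ {zero}  {suc k} _         = refl
<⇒≢ᵇ {suc x} {suc k} (s≤s x<k) = <⇒≢ᵇ x<k

>⇒≢ᵇ : ∀ {x k} → x < k → (k ≡ᵇ x) ≡ false
>⇒≢ᵇ {zero}  {suc zero}    _         = refl
>⇒≢ᵇ {zero}  {suc (suc k)} _         = refl
>⇒≢ᵇ {suc x} {suc k}       (s≤s x<k) = >⇒≢ᵇ x<k

<⇒<ᵇ : ∀ {x M} → x < M → (x <ᵇ M) ≡ true
<⇒<ᵇ {zero}  {suc M} _         = refl
<⇒<ᵇ {suc x} {suc M} (s≤s x<M) = <⇒<ᵇ x<M

<⇒≮ᵇ : ∀ {x M} → x < M → (M <ᵇ x) ≡ false
<⇒≮ᵇ {zero}  {suc M} _         = refl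
<⇒≮ᵇ {suc x} {suc M} (s≤s x<M) = <⇒≮ᵇ x<M

afterLetter : ℕ → (List ℕ → ℕ) → List ℕ → ℕ
afterLetter x P τ = 𝟙 (notIn x τ) * P (x ∷ τ)

distinct-∷ : ∀ x σ (P : List ℕ → ℕ) → 𝟙 (distinct (x ∷ σ)) * P (x ∷ σ) ≡ 𝟙 (distinct σ) * afterLetter x P σ
distinct-∷ x σ P = begin
  𝟙 (notIn x σ ∧ distinct σ) * P (x ∷ σ)       ≡⟨ cong (_* P (x ∷ σ)) (𝟙-∧ (notIn x σ) (distinct σ)) ⟩
  𝟙 (notIn x σ) * 𝟙 (distinct σ) * P (x ∷ σ)  ≡⟨ cong (_* P (x ∷ σ)) (*-comm (𝟙 (notIn x σ)) _) ⟩
  𝟙 (distinct σ) * 𝟙 (notIn x σ) * P (x ∷ σ)  ≡⟨ *-assoc (𝟙 (distinct σ)) _ (P (x ∷ σ)) ⟩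
  𝟙 (distinct σ) * afterLetter x P σ ∎

-- insertAt p M σ inserts the letter M at position p of σ (at the end if p ≥ length σ).
insertAt : ℕ → ℕ → List ℕ → List ℕ
insertAt zero    M σ       = M ∷ σ
insertAt (suc p) M []      = M ∷ []
insertAt (suc p) M (y ∷ σ) = y ∷ insertAt p M σ

notIn-insertAt : ∀ {x k} → (x ≡ᵇ k) ≡ false → ∀ p σ → notIn x (insertAt p k σ) ≡ notIn x σ
notIn-insertAt x≢k zero    σ       rewrite x≢k = refl
notIn-insertAt x≢k (suc p) []      rewrite x≢k = refl
notIn-insertAt {x} x≢k (suc p) (y ∷ σ) = cong (not (x ≡ᵇ y) ∧_) (notIn-insertAt x≢k p σ)

wordSum-avoiding : ∀ m k (Q : List ℕ → ℕ) →
  Σ[ σ ∈ suc k ^ m ] (𝟙 (notIn k σ) * Q σ) ≡ Σ[ σ ∈ k ^ m ] Q σ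
wordSum-avoiding zero    k Q = +-identityʳ (Q [])
wordSum-avoiding (suc m) k Q = begin
  Σ[ x < suc k ] wordSum m (suc k) (λ σ → 𝟙 (notIn k (x ∷ σ)) * Q (x ∷ σ))
    ≡⟨ Σ-last k _ ⟩
  (Σ[ x < k ] wordSum m (suc k) (λ σ → 𝟙 (notIn k (x ∷ σ)) * Q (x ∷ σ)))
    + wordSum m (suc k) (λ σ → 𝟙 (notIn k (k ∷ σ)) * Q (k ∷ σ))
    ≡⟨ cong₂ _+_ (Σ-cong< k letter-below-k) letter-k ⟩
  (Σ[ x < k ] wordSum m k (Q ∘ (x ∷_))) + 0
    ≡⟨ +-identityʳ _ ⟩
  Σ[ x < k ] wordSum m k (Q ∘ (x ∷_)) ∎
  where
  letter-below-k : ∀ x → x < k →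
    wordSum m (suc k) (λ σ → 𝟙 (notIn k (x ∷ σ)) * Q (x ∷ σ)) ≡ wordSum m k (Q ∘ (x ∷_))
  letter-below-k x x<k = trans
    (wordSum-ext m (suc k) (λ σ → cong (λ b → 𝟙 (not b ∧ notIn k σ) * Q (x ∷ σ)) (>⇒≢ᵇ x<k)))
    (wordSum-avoiding m k (Q ∘ (x ∷_)))
  letter-k : wordSum m (suc k) (λ σ → 𝟙 (notIn k (k ∷ σ)) * Q (k ∷ σ)) ≡ 0
  letter-k = trans
    (wordSum-ext m (suc k) (λ σ → cong (λ b → 𝟙 (not b ∧ notIn k σ) * Q (k ∷ σ)) (≡ᵇ-refl k)))
    (wordSum-zero m (suc k))

-- Words starting with the largest letter k: the rest avoids k, so it is a word over {0,…,k-1}.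
first-letter-max : ∀ m k (P : List ℕ → ℕ) →
  Σ[ σ ∈ suc k ^ m ] ifDistinct P (k ∷ σ) ≡ Σ[ σ ∈ k ^ m ] ifDistinct (P ∘ (k ∷_)) σ
first-letter-max m k P = begin
  Σ[ σ ∈ suc k ^ m ] ifDistinct P (k ∷ σ)
    ≡⟨ wordSum-ext m (suc k) (λ σ → trans (distinct-∷ k σ P)
         (x∙yz≈y∙xz *-commutativeSemigroup (𝟙 (distinct σ)) (𝟙 (notIn k σ)) _)) ⟩
  Σ[ σ ∈ suc k ^ m ] (𝟙 (notIn k σ) * ifDistinct (P ∘ (k ∷_)) σ)
    ≡⟨ wordSum-avoiding m k (ifDistinct (P ∘ (k ∷_))) ⟩
  Σ[ σ ∈ k ^ m ] ifDistinct (P ∘ (k ∷_)) σ ∎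

ifDistinct-∷-insertAt : ∀ {x k} → x < k → ∀ (P : List ℕ → ℕ) p σ →
  ifDistinct (afterLetter x P ∘ insertAt p k) σ ≡ ifDistinct (P ∘ insertAt (suc p) k) (x ∷ σ)
ifDistinct-∷-insertAt {x} {k} x<k P p σ = begin
  𝟙 (distinct σ) * (𝟙 (notIn x (insertAt p k σ)) * P (x ∷ insertAt p k σ))
    ≡⟨ cong (λ b → 𝟙 (distinct σ) * (𝟙 b * P (x ∷ insertAt p k σ))) (notIn-insertAt (<⇒≢ᵇ x<k) p σ) ⟩
  𝟙 (distinct σ) * (𝟙 (notIn x σ) * P (x ∷ insertAt p k σ))
    ≡⟨ sym (distinct-∷ x σ (P ∘ insertAt (suc p) k)) ⟩
  ifDistinct (P ∘ insertAt (suc p) k) (x ∷ σ) ∎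
-- A word τ of length m+1 over {0,…,k} without repeated letters either avoids k,
-- or contains k exactly once: τ = insertAt p k σ with σ over {0,…,k-1}.
distinct-split : ∀ m k (P : List ℕ → ℕ) →
  Σ[ τ ∈ suc k ^ suc m ] ifDistinct P τ ≡
  (Σ[ τ ∈ k ^ suc m ] ifDistinct P τ) + (Σ[ p < suc m ] Σ[ σ ∈ k ^ m ] ifDistinct (P ∘ insertAt p k) σ)
distinct-split zero k P = begin
  Σ[ x < suc k ] ifDistinct P (x ∷ [])
    ≡⟨ Σ-last k (λ x → ifDistinct P (x ∷ [])) ⟩
  (Σ[ x < k ] ifDistinct P (x ∷ [])) + ifDistinct P (k ∷ [])
    ≡⟨ cong ((Σ[ x < k ] ifDistinct P (x ∷ [])) +_) (sym (+-identityʳ _)) ⟩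
  (Σ[ x < k ] ifDistinct P (x ∷ [])) + (ifDistinct P (k ∷ []) + 0) ∎
distinct-split (suc m) k P = begin
  Σ[ x < suc k ] G x
    ≡⟨ Σ-last k G ⟩
  (Σ[ x < k ] G x) + G k
    ≡⟨ cong₂ _+_ (Σ-cong< k first-letter-below-k) (first-letter-max (suc m) k P) ⟩
  (Σ[ x < k ] (A x + B x)) + C
    ≡⟨ cong (_+ C) (Σ-+ k A B) ⟩
  ((Σ[ x < k ] A x) + (Σ[ x < k ] B x)) + C
    ≡⟨ +-assoc (Σ[ x < k ] A x) _ C ⟩
  (Σ[ x < k ] A x) + ((Σ[ x < k ] B x) + C)
    ≡⟨ cong ((Σ[ x < k ] A x) +_) (+-comm _ C) ⟩
  (Σ[ x < k ] A x) + (C + (Σ[ x < k ] B x))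
    ≡⟨ cong (λ s → (Σ[ x < k ] A x) + (C + s)) (Σ-comm k (suc m) (λ x p → wordSum m k (Q p ∘ (x ∷_)))) ⟩
  (Σ[ x < k ] A x) + (C + (Σ[ p < suc m ] wordSum (suc m) k (Q p))) ∎
  where
  G A B : ℕ → ℕ
  G x = Σ[ σ ∈ suc k ^ suc m ] ifDistinct P (x ∷ σ)
  A x = Σ[ σ ∈ k ^ suc m ] ifDistinct P (x ∷ σ)
  Q : ℕ → List ℕ → ℕ
  Q p = ifDistinct (P ∘ insertAt (suc p) k)
  B x = Σ[ p < suc m ] Σ[ σ ∈ k ^ m ] Q p (x ∷ σ)
  C : ℕ
  C = Σ[ σ ∈ k ^ suc m ] ifDistinct (P ∘ (k ∷_)) σ
  -- x < k: the rest of τ avoids x, and the induction hypothesis applies to it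
  first-letter-below-k : ∀ x → x < k → G x ≡ A x + B x
  first-letter-below-k x x<k = begin
    G x
      ≡⟨ wordSum-ext (suc m) (suc k) (λ σ → distinct-∷ x σ P) ⟩
    Σ[ σ ∈ suc k ^ suc m ] ifDistinct (afterLetter x P) σ
      ≡⟨ distinct-split m k (afterLetter x P) ⟩
    (Σ[ σ ∈ k ^ suc m ] ifDistinct (afterLetter x P) σ)
      + (Σ[ p < suc m ] Σ[ σ ∈ k ^ m ] ifDistinct (afterLetter x P ∘ insertAt p k) σ)
      ≡⟨ cong₂ _+_ (wordSum-ext (suc m) k (λ σ → sym (distinct-∷ x σ P)))
                   (Σ-cong (suc m) (λ p → wordSum-ext m k (ifDistinct-∷-insertAt x<k P p))) ⟩
    A x + B x ∎

-- Pigeonhole, in counting form: a word longer than the alphabet repeats a letter.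
distinct-pigeonhole : ∀ k m → k < m → (P : List ℕ → ℕ) → Σ[ τ ∈ k ^ m ] ifDistinct P τ ≡ 0
distinct-pigeonhole zero    (suc m) _         P = refl
distinct-pigeonhole (suc k) (suc m) (s≤s k<m) P = begin
  Σ[ τ ∈ suc k ^ suc m ] ifDistinct P τ
    ≡⟨ distinct-split m k P ⟩
  (Σ[ τ ∈ k ^ suc m ] ifDistinct P τ) + (Σ[ p < suc m ] Σ[ σ ∈ k ^ m ] ifDistinct (P ∘ insertAt p k) σ)
    ≡⟨ cong₂ _+_ (distinct-pigeonhole k (suc m) (m≤n⇒m≤1+n k<m) P)
                 (Σ-cong (suc m) (λ p → distinct-pigeonhole k m k<m (P ∘ insertAt p k))) ⟩
  0 + (Σ[ p < suc m ] 0)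
    ≡⟨ Σ-zero (suc m) ⟩
  0 ∎

-- Removing the maximal letter N: a permutation of {0,…,N} is a permutation σ of
-- {0,…,N-1} together with the position p at which N is inserted.
remove-max : ∀ N (P : List ℕ → ℕ) →
  Σ[ τ ∈ suc N ^ suc N ] ifDistinct P τ ≡
  Σ[ σ ∈ N ^ N ] (𝟙 (distinct σ) * Σ[ p < suc N ] P (insertAt p N σ))
remove-max N P = begin
  Σ[ τ ∈ suc N ^ suc N ] ifDistinct P τ
    ≡⟨ distinct-split N N P ⟩
  (Σ[ τ ∈ N ^ suc N ] ifDistinct P τ) + (Σ[ p < suc N ] Σ[ σ ∈ N ^ N ] ifDistinct (P ∘ insertAt p N) σ)
    ≡⟨ cong (_+ (Σ[ p < suc N ] Σ[ σ ∈ N ^ N ] ifDistinct (P ∘ insertAt p N) σ))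
            (distinct-pigeonhole N (suc N) ≤-refl P) ⟩
  Σ[ p < suc N ] Σ[ σ ∈ N ^ N ] ifDistinct (P ∘ insertAt p N) σ
    ≡⟨ sym (wordSum-Σ N N (suc N) (λ p → ifDistinct (P ∘ insertAt p N))) ⟩
  Σ[ σ ∈ N ^ N ] Σ[ p < suc N ] ifDistinct (P ∘ insertAt p N) σ
    ≡⟨ wordSum-ext N N (λ σ → Σ-* (suc N) (𝟙 (distinct σ)) (λ p → P (insertAt p N σ))) ⟩
  Σ[ σ ∈ N ^ N ] (𝟙 (distinct σ) * Σ[ p < suc N ] P (insertAt p N σ)) ∎

-- Up/down patterns are words over Bool: the letter true (false) demands an ascent
-- (descent) at the corresponding step, as in  follows.
step : Bool → ℕ → ℕ → Bool
step d x y = if d then x <ᵇ y else y <ᵇ x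

countFollowing : List (List Bool) → List ℕ → ℕ
countFollowing vs σ = sum (map (λ v → 𝟙 (follows v σ)) vs)

countFollowing-∷ : ∀ d x y σ vs →
  countFollowing (map (d ∷_) vs) (x ∷ y ∷ σ) ≡ 𝟙 (step d x y) * countFollowing vs (y ∷ σ)
countFollowing-∷ d x y σ []       = sym (*-zeroʳ (𝟙 (step d x y)))
countFollowing-∷ d x y σ (v ∷ vs) =
  trans (cong₂ _+_ (𝟙-∧ (step d x y) (follows v (y ∷ σ))) (countFollowing-∷ d x y σ vs))
        (sym (*-distribˡ-+ (𝟙 (step d x y)) _ _))

descent-or-ascent : ∀ x y F → (x ≡ᵇ y) ≡ false → 𝟙 (step false x y ∧ F) + 𝟙 (step true x y ∧ F) ≡ 𝟙 F
descent-or-ascent zero    zero    F ()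
descent-or-ascent zero    (suc y) F _   = refl
descent-or-ascent (suc x) zero    F _   = +-identityʳ (𝟙 F)
descent-or-ascent (suc x) (suc y) F x≢y = descent-or-ascent x y F x≢y

distinct-head : ∀ x y σ → distinct (x ∷ y ∷ σ) ≡ true → (x ≡ᵇ y) ≡ false
distinct-head x y σ x∷y∷σ-distinct with x ≡ᵇ y | x∷y∷σ-distinct
... | false | _  = refl
... | true  | ()

distinct-tail : ∀ x σ → distinct (x ∷ σ) ≡ true → distinct σ ≡ true
distinct-tail x σ x∷σ-distinct with notIn x σ | x∷σ-distinct
... | true | σ-distinct = σ-distinct

-- A maximal letter can only be inserted at a peak of a pattern: after an ascent
-- (or at the start) and before a descent (or at the end).  Removing it merges the
-- two steps around the peak into one step between letters of σ, which may go either
-- way.  collapse w lists the patterns so obtained, one for each peak at an end of w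
-- and two for each interior peak; collapseAfter d w does this for the pattern d ∷ w,
-- inserting only after its first letter.
collapseAfter : Bool → List Bool → List (List Bool)
collapseAfter true  []          = [] ∷ []
collapseAfter false []          = []
collapseAfter true  (false ∷ w) = (false ∷ w) ∷ (true ∷ w) ∷ map (true ∷_) (collapseAfter false w)
collapseAfter true  (true ∷ w)  = map (true ∷_) (collapseAfter true w)
collapseAfter false (e ∷ w)     = map (false ∷_) (collapseAfter e w)

collapse : List Bool → List (List Bool)
collapse []          = [] ∷ []
collapse (false ∷ w) = w ∷ collapseAfter false w
collapse (true ∷ w)  = collapseAfter true w

insert-max-after : ∀ M d w x σ →
  length σ ≡ length w → List.All (_< M) (x ∷ σ) → distinct (x ∷ σ) ≡ true →
  Σ[ p < suc (length w) ] 𝟙 (follows (d ∷ w) (x ∷ insertAt p M σ)) ≡ countFollowing (collapseAfter d w) (x ∷ σ)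
insert-max-after M true  []      x []      _ (x<M List.∷ _) _ rewrite <⇒<ᵇ x<M = refl
insert-max-after M false []      x []      _ (x<M List.∷ _) _ rewrite <⇒≮ᵇ x<M = refl
insert-max-after M d     (e ∷ w) x (y ∷ σ) |σ|≡|w| (x<M List.∷ y<M List.∷ σ<M) x∷y∷σ-distinct = begin
  𝟙 (follows (d ∷ e ∷ w) (x ∷ M ∷ y ∷ σ))
    + (Σ[ p < suc (length w) ] 𝟙 (step d x y ∧ follows (e ∷ w) (y ∷ insertAt p M σ)))
    ≡⟨ cong (𝟙 (follows (d ∷ e ∷ w) (x ∷ M ∷ y ∷ σ)) +_) later-positions ⟩
  𝟙 (follows (d ∷ e ∷ w) (x ∷ M ∷ y ∷ σ)) + 𝟙 (step d x y) * countFollowing (collapseAfter e w) (y ∷ σ)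
    ≡⟨ position-one d e ⟩
  countFollowing (collapseAfter d (e ∷ w)) (x ∷ y ∷ σ) ∎
  where
  F : Bool
  F = follows w (y ∷ σ)
  x≢y : (x ≡ᵇ y) ≡ false
  x≢y = distinct-head x y σ x∷y∷σ-distinct
  later-positions : Σ[ p < suc (length w) ] 𝟙 (step d x y ∧ follows (e ∷ w) (y ∷ insertAt p M σ))
                  ≡ 𝟙 (step d x y) * countFollowing (collapseAfter e w) (y ∷ σ)
  later-positions = begin
    Σ[ p < suc (length w) ] 𝟙 (step d x y ∧ follows (e ∷ w) (y ∷ insertAt p M σ))
      ≡⟨ Σ-cong (suc (length w)) (λ p → 𝟙-∧ (step d x y) (follows (e ∷ w) (y ∷ insertAt p M σ))) ⟩
    Σ[ p < suc (length w) ] (𝟙 (step d x y) * 𝟙 (follows (e ∷ w) (y ∷ insertAt p M σ)))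
      ≡⟨ Σ-* (suc (length w)) (𝟙 (step d x y)) (λ p → 𝟙 (follows (e ∷ w) (y ∷ insertAt p M σ))) ⟩
    𝟙 (step d x y) * (Σ[ p < suc (length w) ] 𝟙 (follows (e ∷ w) (y ∷ insertAt p M σ)))
      ≡⟨ cong (𝟙 (step d x y) *_) (insert-max-after M e w y σ (cong pred |σ|≡|w|) (y<M List.∷ σ<M)
                                                   (distinct-tail x (y ∷ σ) x∷y∷σ-distinct)) ⟩
    𝟙 (step d x y) * countFollowing (collapseAfter e w) (y ∷ σ) ∎
  -- inserting M right after x: a peak exactly when d is an ascent and e a descent
  position-one : ∀ d e →
    𝟙 (follows (d ∷ e ∷ w) (x ∷ M ∷ y ∷ σ)) + 𝟙 (step d x y) * countFollowing (collapseAfter e w) (y ∷ σ)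
                       ≡ countFollowing (collapseAfter d (e ∷ w)) (x ∷ y ∷ σ)
  position-one true true rewrite <⇒<ᵇ x<M | <⇒≮ᵇ y<M = sym (countFollowing-∷ true x y σ (collapseAfter true w))
  position-one true false rewrite <⇒<ᵇ x<M | <⇒<ᵇ y<M = begin
    𝟙 F + 𝟙 (x <ᵇ y) * countFollowing (collapseAfter false w) (y ∷ σ)
      ≡⟨ cong (_+ 𝟙 (x <ᵇ y) * countFollowing (collapseAfter false w) (y ∷ σ))
              (sym (descent-or-ascent x y F x≢y)) ⟩
    (𝟙 ((y <ᵇ x) ∧ F) + 𝟙 ((x <ᵇ y) ∧ F)) + 𝟙 (x <ᵇ y) * countFollowing (collapseAfter false w) (y ∷ σ)
      ≡⟨ +-assoc (𝟙 ((y <ᵇ x) ∧ F)) _ _ ⟩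
    𝟙 ((y <ᵇ x) ∧ F) + (𝟙 ((x <ᵇ y) ∧ F) + 𝟙 (x <ᵇ y) * countFollowing (collapseAfter false w) (y ∷ σ))
      ≡⟨ cong (λ s → 𝟙 ((y <ᵇ x) ∧ F) + (𝟙 ((x <ᵇ y) ∧ F) + s))
              (sym (countFollowing-∷ true x y σ (collapseAfter false w))) ⟩
    countFollowing (collapseAfter true (false ∷ w)) (x ∷ y ∷ σ) ∎
  position-one false e rewrite <⇒≮ᵇ x<M = sym (countFollowing-∷ false x y σ (collapseAfter e w))

insert-max-follows : ∀ M w σ → length σ ≡ length w → List.All (_< M) σ → distinct σ ≡ true →
  Σ[ p < suc (length w) ] 𝟙 (follows w (insertAt p M σ)) ≡ countFollowing (collapse w) σ
insert-max-follows M []      []      _ _ _ = refl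
insert-max-follows M (e ∷ w) (y ∷ σ) |σ|≡|w| (y<M List.∷ σ<M) y∷σ-distinct = begin
  𝟙 (follows (e ∷ w) (M ∷ y ∷ σ)) + (Σ[ p < suc (length w) ] 𝟙 (follows (e ∷ w) (y ∷ insertAt p M σ)))
    ≡⟨ cong (𝟙 (follows (e ∷ w) (M ∷ y ∷ σ)) +_)
            (insert-max-after M e w y σ (cong pred |σ|≡|w|) (y<M List.∷ σ<M) y∷σ-distinct) ⟩
  𝟙 (follows (e ∷ w) (M ∷ y ∷ σ)) + countFollowing (collapseAfter e w) (y ∷ σ)
    ≡⟨ position-zero e ⟩
  countFollowing (collapse (e ∷ w)) (y ∷ σ) ∎
  where
  -- inserting M in front: a peak exactly when the pattern starts with a descent
  position-zero : ∀ e → 𝟙 (follows (e ∷ w) (M ∷ y ∷ σ)) + countFollowing (collapseAfter e w) (y ∷ σ)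
                      ≡ countFollowing (collapse (e ∷ w)) (y ∷ σ)
  position-zero true  rewrite <⇒≮ᵇ y<M = refl
  position-zero false rewrite <⇒<ᵇ y<M = refl

decrements : List ℕ → List (List ℕ)
decrements []       = []
decrements (a ∷ as) = (pred a ∷ as) ∷ map (a ∷_) (decrements as)

collapseAfter-replicate : ∀ b j X →
  collapseAfter b (replicate j b ++ X) ≡ map (replicate j b ++_) (collapseAfter b X)
collapseAfter-replicate b zero X = sym (map-id (collapseAfter b X))
collapseAfter-replicate true (suc j) X =
  trans (cong (map (true ∷_)) (collapseAfter-replicate true j X)) (sym (map-∘ (collapseAfter true X)))
collapseAfter-replicate false (suc j) X =
  trans (cong (map (false ∷_)) (collapseAfter-replicate false j X)) (sym (map-∘ (collapseAfter false X)))

replicate-++-∷ : ∀ j (b : Bool) Y → replicate j b ++ b ∷ Y ≡ b ∷ replicate j b ++ Y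
replicate-++-∷ zero    b Y = refl
replicate-++-∷ (suc j) b Y = cong (b ∷_) (replicate-++-∷ j b Y)

-- The peaks of the block pattern dirs L sit at the ends of its ascending (odd) blocks;
-- collapsing the peak between blocks k and k+1 shortens one of these two blocks, and a
-- peak at the very end shortens the last block.  So, when all blocks are nonempty,
-- the collapsed patterns are exactly the patterns of the decrements of L.
mutual
  collapse-dirs : ∀ a as → List.All (1 ≤_) (a ∷ as) →
    collapse (dirs (a ∷ as)) ≡ map dirs (decrements (a ∷ as))
  collapse-dirs zero     as             (() List.∷ _)
  collapse-dirs (suc a') []             _ = collapseAfter-replicate true a' []
  collapse-dirs (suc a') (zero ∷ as)    (_ List.∷ () List.∷ _)
  collapse-dirs (suc a') (suc b' ∷ as) (_ List.∷ _ List.∷ as-pos) = begin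
    collapseAfter true (ups ++ false ∷ R)
      ≡⟨ collapseAfter-replicate true a' (false ∷ R) ⟩
    map (ups ++_) ((false ∷ R) ∷ (true ∷ R) ∷ map (true ∷_) (collapseAfter false (downs ++ dirs as)))
      ≡⟨ cong (λ vs → map (ups ++_) ((false ∷ R) ∷ (true ∷ R) ∷ map (true ∷_) vs))
              (collapseAfter-replicate false b' (dirs as)) ⟩
    (ups ++ false ∷ R) ∷ (ups ++ true ∷ R)
      ∷ map (ups ++_) (map (true ∷_) (map (downs ++_) (collapseAfter false (dirs as))))
      ≡⟨ cong₂ (λ v vs → (ups ++ false ∷ R) ∷ v ∷ vs) (replicate-++-∷ a' true R) later-peaks ⟩
    map dirs (decrements (suc a' ∷ suc b' ∷ as)) ∎
    where
    ups downs : List Bool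
    ups   = replicate a' true
    downs = replicate b' false
    R : List Bool
    R = downs ++ dirs as
    pattern-of : ∀ L → ups ++ true ∷ downs ++ false ∷ dirs L ≡ dirs (suc a' ∷ suc b' ∷ L)
    pattern-of L = trans (replicate-++-∷ a' true _)
                         (cong (λ u → true ∷ ups ++ u) (replicate-++-∷ b' false (dirs L)))
    later-peaks : map (ups ++_) (map (true ∷_) (map (downs ++_) (collapseAfter false (dirs as))))
                ≡ map dirs (map (suc a' ∷_) (map (suc b' ∷_) (decrements as)))
    later-peaks = begin
      map (ups ++_) (map (true ∷_) (map (downs ++_) (collapseAfter false (dirs as))))
        ≡⟨ cong (λ vs → map (ups ++_) (map (true ∷_) (map (downs ++_) vs))) (collapseAfter-descent as as-pos) ⟩
      map (ups ++_) (map (true ∷_) (map (downs ++_) (map ((false ∷_) ∘ dirs) (decrements as))))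
        ≡⟨ sym (trans (map-∘ (decrements as)) (cong (map (ups ++_))
                (trans (map-∘ (decrements as)) (cong (map (true ∷_)) (map-∘ (decrements as)))))) ⟩
      map (λ L → ups ++ true ∷ downs ++ false ∷ dirs L) (decrements as)
        ≡⟨ map-cong pattern-of (decrements as) ⟩
      map (λ L → dirs (suc a' ∷ suc b' ∷ L)) (decrements as)
        ≡⟨ trans (map-∘ (decrements as)) (cong (map dirs) (map-∘ (decrements as))) ⟩
      map dirs (map (suc a' ∷_) (map (suc b' ∷_) (decrements as))) ∎

  collapseAfter-descent : ∀ as → List.All (1 ≤_) as →
    collapseAfter false (dirs as) ≡ map ((false ∷_) ∘ dirs) (decrements as)
  collapseAfter-descent []            _             = refl
  collapseAfter-descent (zero ∷ as)   (() List.∷ _)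
  collapseAfter-descent (suc a' ∷ as) as-pos =
    trans (cong (map (false ∷_)) (collapse-dirs (suc a') as as-pos)) (sym (map-∘ (decrements (suc a' ∷ as))))

length-dirsFrom : ∀ b L → length (dirsFrom b L) ≡ sum L
length-dirsFrom b []       = refl
length-dirsFrom b (a ∷ as) =
  trans (length-++ (replicate a b)) (cong₂ _+_ (length-replicate a) (length-dirsFrom (not b) as))

sum-decrements : ∀ L → List.All (1 ≤_) L → List.All (λ L′ → suc (sum L′) ≡ sum L) (decrements L)
sum-decrements []           _                 = List.[]
sum-decrements (zero ∷ as)  (() List.∷ _)
sum-decrements (suc a ∷ as) (_ List.∷ as-pos) =
  refl List.∷ map⁺ (List.map (λ {L′} → shift {L′}) (sum-decrements as as-pos))
  where
  shift : ∀ {L′} → suc (sum L′) ≡ sum as → suc (sum (suc a ∷ L′)) ≡ sum (suc a ∷ as)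
  shift {L′} eq = cong suc (trans (sym (+-suc a (sum L′))) (cong (a +_) eq))

*-sum : ∀ {A : Set} c (f : A → ℕ) vs → c * sum (map f vs) ≡ sum (map (λ v → c * f v) vs)
*-sum c f []       = *-zeroʳ c
*-sum c f (v ∷ vs) = trans (*-distribˡ-+ c (f v) _) (cong (c * f v +_) (*-sum c f vs))

-- A factor 𝟙 b lets us use b ≡ true when rewriting the other factor.
𝟙-guard : ∀ b {A B} → (b ≡ true → A ≡ B) → 𝟙 b * A ≡ 𝟙 b * B
𝟙-guard true  A≡B = cong (_+ 0) (A≡B refl)
𝟙-guard false A≡B = refl

-- The recurrence for block sequences with positive entries: remove the maximum N
-- from each counted permutation and collapse the peak of dirs L where it sat.
Ω-recurrence : ∀ a as → List.All (1 ≤_) (a ∷ as) → Ω (a ∷ as) ≡ sum (map Ω (decrements (a ∷ as)))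
Ω-recurrence a as pos = begin
  Ω L
    ≡⟨ Ω-as-wordSum L ⟩
  Σ[ τ ∈ suc N ^ suc N ] ifDistinct (𝟙 ∘ follows W) τ
    ≡⟨ remove-max N (𝟙 ∘ follows W) ⟩
  Σ[ σ ∈ N ^ N ] (𝟙 (distinct σ) * Σ[ p < suc N ] 𝟙 (follows W (insertAt p N σ)))
    ≡⟨ wordSum-cong N N (λ σ |σ|≡N σ<N → 𝟙-guard (distinct σ) (insertions σ |σ|≡N σ<N)) ⟩
  Σ[ σ ∈ N ^ N ] (𝟙 (distinct σ) * countFollowing (collapse W) σ)
    ≡⟨ wordSum-ext N N (λ σ → *-sum (𝟙 (distinct σ)) (λ v → 𝟙 (follows v σ)) (collapse W)) ⟩
  Σ[ σ ∈ N ^ N ] sum (map (λ v → ifDistinct (𝟙 ∘ follows v) σ) (collapse W))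
    ≡⟨ wordSum-sum N N (λ v → ifDistinct (𝟙 ∘ follows v)) (collapse W) ⟩
  sum (map count (collapse W))
    ≡⟨ cong (sum ∘ map count) (collapse-dirs a as pos) ⟩
  sum (map count (map dirs (decrements L)))
    ≡⟨ cong sum (sym (map-∘ (decrements L))) ⟩
  sum (map (count ∘ dirs) (decrements L))
    ≡⟨ cong sum (map-cong-local (List.map (λ {L′} → count-decrement L′) (sum-decrements L pos))) ⟩
  sum (map Ω (decrements L)) ∎
  where
  L : List ℕ
  L = a ∷ as
  N : ℕ
  N = sum L
  W : List Bool
  W = dirs L
  count : List Bool → ℕ
  count v = Σ[ σ ∈ N ^ N ] ifDistinct (𝟙 ∘ follows v) σ
  |W|≡N : length W ≡ N
  |W|≡N = length-dirsFrom true L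
  insertions : ∀ σ → length σ ≡ N → List.All (_< N) σ → distinct σ ≡ true →
    Σ[ p < suc N ] 𝟙 (follows W (insertAt p N σ)) ≡ countFollowing (collapse W) σ
  insertions σ |σ|≡N σ<N σ-distinct =
    trans (cong (λ n → Σ[ p < suc n ] 𝟙 (follows W (insertAt p N σ))) (sym |W|≡N))
          (insert-max-follows N W σ (trans |σ|≡N (sym |W|≡N)) σ<N σ-distinct)
  count-decrement : ∀ L′ {M} → suc (sum L′) ≡ M →
    Σ[ σ ∈ M ^ M ] ifDistinct (𝟙 ∘ follows (dirs L′)) σ ≡ Ω L′
  count-decrement L′ refl = sym (Ω-as-wordSum L′)

tabulate-decrements : ∀ {n} (i : Vec ℕ n) → tabulate (λ k → toList (i [ k ]%= pred)) ≡ decrements (toList i)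
tabulate-decrements Vec.[]       = refl
tabulate-decrements (x Vec.∷ xs) = cong ((pred x ∷ toList xs) ∷_)
  (trans (sym (map-tabulate (λ k → toList (xs [ k ]%= pred)) (x ∷_))) (cong (map (x ∷_)) (tabulate-decrements xs)))

theorem1 : (n : ℕ) → 1 ≤ n → (i : Vec ℕ n) → All (λ x → 1 ≤ x) i →
    Ω (toList i) ≡ sum (map (λ (k : Fin n) → Ω (toList (i [ k ]%= pred))) (allFin n))
theorem1 zero    () _ _
theorem1 (suc n) _ i@(a Vec.∷ as) i-pos = begin
  Ω (toList i)
    ≡⟨ Ω-recurrence a (toList as) (toList⁺ i-pos) ⟩
  sum (map Ω (decrements (toList i)))
    ≡⟨ cong (sum ∘ map Ω) (sym (tabulate-decrements i)) ⟩
  sum (map Ω (tabulate (λ k → toList (i [ k ]%= pred))))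
    ≡⟨ cong sum (map-tabulate (λ k → toList (i [ k ]%= pred)) Ω) ⟩
  sum (tabulate (λ k → Ω (toList (i [ k ]%= pred))))
    ≡⟨ cong sum (sym (map-tabulate (λ k → k) (λ k → Ω (toList (i [ k ]%= pred))))) ⟩
  sum (map (λ k → Ω (toList (i [ k ]%= pred))) (allFin (suc n))) ∎
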